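{- Let $\mathcal{GJL}_{CS}$ be any one of $\mathcal{GJ}_{CS},\mathcal{GJT}_{CS},\mathcal{GJ}4_{CS},\mathcal{GLP}_{CS},\mathcal{GJ}45_{CS},\mathcal{GJT}45_{CS}$ (with $CS$ a constant specification for that calculus), and let $Th_{\mathcal{GJL}_{CS}}=\{\psi\in\mathcal{L}_J\mid\ \vdash_{\mathcal{GJL}_{CS}}\psi\}$. For all $\Gamma\cup\{\phi\}\subseteq\mathcal{L}_J$: $\Gamma\vdash_{\mathcal{GJL}_{CS}}\phi$ if and only if $\Gamma^\star\cup(Th_{\mathcal{GJL}_{CS}})^\star\vdash_{\mathcal{G}}\phi^\star$.
   Context: Justification terms $Jt$: $t::=x\mid c\mid[t\cdot t]\mid[t+t]\mid\,!t\mid\,?t$ ($x$ term variables, $c$ constants). Formulas $\mathcal{L}_J$: $\phi::=\bot\mid p\mid(\phi\land\phi)\mid(\phi\rightarrow\phi)\mid t:\phi$, $p\in Var=\{p_i\mid i\in\mathbb{N}\}$; $\neg\phi:=\phi\to\bot$. Translation: $\mathcal{L}_0^\star$ is the propositional language (built from $\bot$, $\land$, $\to$) over the variable set $Var\cup\{\phi_t\mid\phi\in\mathcal{L}_J,t\in Jt\}$, where each $\phi_t$ is a fresh propositional variable. $\star:\mathcal{L}_J\to\mathcal{L}_0^\star$: $\bot^\star=\bot$, $p^\star=p$, $(\phi\land\psi)^\star=\phi^\star\land\psi^\star$, $(\phi\to\psi)^\star=\phi^\star\to\psi^\star$, $(t:\phi)^\star=\phi_t$; $\Gamma^\star=\{\psi^\star\mid\psi\in\Gamma\}$.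 Calculi: $\mathcal{G}$ (propositional Gödel logic, applied here over $\mathcal{L}_0^\star$) has axiom schemes (A1) $(\phi\to\psi)\to((\psi\to\chi)\to(\phi\to\chi))$, (A2) $(\phi\land\psi)\to\phi$, (A3) $(\phi\land\psi)\to(\psi\land\phi)$, (A5a) $(\phi\to(\psi\to\chi))\to((\phi\land\psi)\to\chi)$, (A5b) $((\phi\land\psi)\to\chi)\to(\phi\to(\psi\to\chi))$, (A6) $((\phi\to\psi)\to\chi)\to(((\psi\to\phi)\to\chi)\to\chi)$, (A7) $\bot\to\phi$, (G4) $\phi\to(\phi\land\phi)$, with modus ponens. $\mathcal{GJ}_0$: all $\mathcal{L}_J$-instances of these, plus (J) $t:(\phi\to\psi)\to(s:\phi\to[t\cdot s]:\psi)$, (+) $t:\phi\to[t+s]:\phi$, $s:\phi\to[t+s]:\phi$, and modus ponens. (F) $t:\phi\to\phi$; (PI) $t:\phi\to\,!t:t:\phi$; (NI) $\neg t:\phi\to\,?t:\neg t:\phi$. A constant specification for a calculus $\mathcal{S}$ is a downward closed set $CS$ of formulas $c_n:\dots:c_1:\phi$ ($n\ge1$, $c_i$ constants, $\phi$ an axiom of $\mathcal{S}$). $\mathcal{GJ}_{CS}$ is $\mathcal{GJ}_0$ plus the rule "infer $c:\psi$ for each $c:\psi\in CS$"; $\mathcal{GJT}_{CS}=\mathcal{GJ}_{CS}+(F)$, $\mathcal{GJ}4_{CS}=\mathcal{GJ}_{CS}+(PI)$, $\mathcal{GLP}_{CS}=\mathcal{GJT}_{CS}+(PI)$, $\mathcal{GJ}45_{CS}=\mathcal{GJ}4_{CS}+(NI)$,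 $\mathcal{GJT}45_{CS}=\mathcal{GJ}45_{CS}+(F)$. $\Gamma\vdash\phi$ denotes derivability from premises $\Gamma$. -}

module Defs where

open import Data.Nat using (ℕ)
open import Data.Product using (Σ; _×_; _,_)
open import Data.Sum using (_⊎_)
open import Relation.Binary.PropositionalEquality using (_≡_)

data Tm : Set where
  tvar  : ℕ → Tm
  tcon  : ℕ → Tm
  _·_   : Tm → Tm → Tm
  _⊕_   : Tm → Tm → Tm
  !_    : Tm → Tm
  ¿_    : Tm → Tm

infixr 5 _⇒_
infixr 6 _∧_
infix 7 _∶_
data Fm : Set where
  ⊥ᶠ  : Fm
  pv  : ℕ → Fm
  _∧_ : Fm → Fm → Fm
  _⇒_ : Fm → Fm → Fm
  _∶_ : Tm → Fm → Fm

¬ᶠ_ : Fm → Fm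
¬ᶠ φ = φ ⇒ ⊥ᶠ

data PF (A : Set) : Set where
  ⊥ₚ   : PF A
  atom : A → PF A
  _∧ₚ_ : PF A → PF A → PF A
  _⇒ₚ_ : PF A → PF A → PF A

-- Atoms of L_0^⋆ : Var ∪ {φ_t | φ ∈ L_J, t ∈ Jt}
Atom⋆ : Set
Atom⋆ = ℕ ⊎ (Fm × Tm)

L0⋆ : Set
L0⋆ = PF Atom⋆

_⋆ : Fm → L0⋆
⊥ᶠ ⋆ = ⊥ₚ
pv n ⋆ = atom (Data.Sum.inj₁ n)
(φ ∧ ψ) ⋆ = (φ ⋆) ∧ₚ (ψ ⋆)
(φ ⇒ ψ) ⋆ = (φ ⋆) ⇒ₚ (ψ ⋆)
(t ∶ φ) ⋆ = atom (Data.Sum.inj₂ (φ , t))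

Pred : Set → Set₁
Pred A = A → Set

image⋆ : Pred Fm → Pred L0⋆
image⋆ Γ χ = Σ Fm (λ ψ → Γ ψ × (ψ ⋆) ≡ χ)

_∪_ : {A : Set} → Pred A → Pred A → Pred A
(P ∪ Q) x = P x ⊎ Q x

module GSchemes {F : Set} (bot : F) (_&_ _↦_ : F → F → F) where
  data GAxiom : F → Set where
    A1  : ∀ φ ψ χ → GAxiom ((φ ↦ ψ) ↦ ((ψ ↦ χ) ↦ (φ ↦ χ)))
    A2  : ∀ φ ψ → GAxiom ((φ & ψ) ↦ φ)
    A3  : ∀ φ ψ → GAxiom ((φ & ψ) ↦ (ψ & φ))
    A5a : ∀ φ ψ χ → GAxiom ((φ ↦ (ψ ↦ χ)) ↦ ((φ & ψ) ↦ χ))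
    A5b : ∀ φ ψ χ → GAxiom (((φ & ψ) ↦ χ) ↦ (φ ↦ (ψ ↦ χ)))
    A6  : ∀ φ ψ χ → GAxiom (((φ ↦ ψ) ↦ χ) ↦ (((ψ ↦ φ) ↦ χ) ↦ χ))
    A7  : ∀ φ → GAxiom (bot ↦ φ)
    G4  : ∀ φ → GAxiom (φ ↦ (φ & φ))

open GSchemes (⊥ₚ {Atom⋆}) _∧ₚ_ _⇒ₚ_ renaming (GAxiom to GAx⋆)

data _⊢G_ (Δ : Pred L0⋆) : L0⋆ → Set where
  prem : ∀ {χ} → Δ χ → Δ ⊢G χ
  ax   : ∀ {χ} → GAx⋆ χ → Δ ⊢G χ
  mp   : ∀ {χ θ} → Δ ⊢G (χ ⇒ₚ θ) → Δ ⊢G χ → Δ ⊢G θ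

open GSchemes ⊥ᶠ _∧_ _⇒_ renaming (GAxiom to GAxJ)

data Logic : Set where
  J JT J4 LP J45 JT45 : Logic

data HasF : Logic → Set where
  fJT : HasF JT
  fLP : HasF LP
  fJT45 : HasF JT45

data HasPI : Logic → Set where
  piJ4 : HasPI J4
  piLP : HasPI LP
  piJ45 : HasPI J45
  piJT45 : HasPI JT45

data HasNI : Logic → Set where
  niJ45 : HasNI J45
  niJT45 : HasNI JT45

data Axiom (L : Logic) : Fm → Set where
  gax  : ∀ {φ} → GAxJ φ → Axiom L φ
  axJ  : ∀ t s φ ψ → Axiom L ((t ∶ (φ ⇒ ψ)) ⇒ ((s ∶ φ) ⇒ ((t · s) ∶ ψ)))
  ax+l : ∀ t s φ → Axiom L ((t ∶ φ) ⇒ ((t ⊕ s) ∶ φ))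
  ax+r : ∀ t s φ → Axiom L ((s ∶ φ) ⇒ ((t ⊕ s) ∶ φ))
  axF  : HasF L → ∀ t φ → Axiom L ((t ∶ φ) ⇒ φ)
  axPI : HasPI L → ∀ t φ → Axiom L ((t ∶ φ) ⇒ ((! t) ∶ (t ∶ φ)))
  axNI : HasNI L → ∀ t φ → Axiom L ((¬ᶠ (t ∶ φ)) ⇒ ((¿ t) ∶ (¬ᶠ (t ∶ φ))))

data ConstChain (L : Logic) : Fm → Set where
  base : ∀ c {φ} → Axiom L φ → ConstChain L (tcon c ∶ φ)
  step : ∀ c {ψ} → ConstChain L ψ → ConstChain L (tcon c ∶ ψ)

record IsCS (L : Logic) (CS : Pred Fm) : Set where
  field
    shape    : ∀ {ψ} → CS ψ → ConstChain L ψ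
    downward : ∀ c ψ → CS (tcon c ∶ ψ) → ConstChain L ψ → CS ψ

data Der (L : Logic) (CS : Pred Fm) (Γ : Pred Fm) : Fm → Set where
  prem : ∀ {φ} → Γ φ → Der L CS Γ φ
  ax   : ∀ {φ} → Axiom L φ → Der L CS Γ φ
  cs   : ∀ {c ψ} → CS (tcon c ∶ ψ) → Der L CS Γ (tcon c ∶ ψ)
  mp   : ∀ {φ ψ} → Der L CS Γ (φ ⇒ ψ) → Der L CS Γ φ → Der L CS Γ ψ

Th : Logic → Pred Fm → Pred Fm
Th L CS ψ = Der L CS (λ _ → Data.Empty.⊥) ψ
  where import Data.Empty

-- The translation ⋆ has a left inverse ⋆⁻¹ that reads each atom φ_t back as t : φ.
-- A Gödel derivation from Γ^⋆ ∪ Th^⋆ therefore pulls back along ⋆⁻¹ to a GJL_CS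
-- derivation: premises become members of Γ or theorems, Gödel axioms over L_0^⋆
-- become Gödel axioms over L_J, and modus ponens is preserved. Conversely every
-- axiom and CS instance of GJL_CS is itself a theorem, so it enters the Gödel
-- derivation as a premise from Th^⋆.
module Submission where

open import Defs
open import Data.Product using (_×_; _,_)
open import Data.Sum using (inj₁; inj₂; [_,_])
open import Relation.Binary.PropositionalEquality using (_≡_; refl; cong₂; subst; sym)

module Gödel⋆ = GSchemes (⊥ₚ {Atom⋆}) _∧ₚ_ _⇒ₚ_
module GödelJ = GSchemes ⊥ᶠ _∧_ _⇒_

_⋆⁻¹ : L0⋆ → Fm
⊥ₚ ⋆⁻¹ = ⊥ᶠ
atom (inj₁ n) ⋆⁻¹ = pv n
atom (inj₂ (φ , t)) ⋆⁻¹ = t ∶ φ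
(χ ∧ₚ θ) ⋆⁻¹ = (χ ⋆⁻¹) ∧ (θ ⋆⁻¹)
(χ ⇒ₚ θ) ⋆⁻¹ = (χ ⋆⁻¹) ⇒ (θ ⋆⁻¹)

⋆⁻¹-⋆ : ∀ φ → (φ ⋆) ⋆⁻¹ ≡ φ
⋆⁻¹-⋆ ⊥ᶠ = refl
⋆⁻¹-⋆ (pv n) = refl
⋆⁻¹-⋆ (φ ∧ ψ) = cong₂ _∧_ (⋆⁻¹-⋆ φ) (⋆⁻¹-⋆ ψ)
⋆⁻¹-⋆ (φ ⇒ ψ) = cong₂ _⇒_ (⋆⁻¹-⋆ φ) (⋆⁻¹-⋆ ψ)
⋆⁻¹-⋆ (t ∶ φ) = refl

⋆⁻¹-GAxiom : ∀ {χ} → Gödel⋆.GAxiom χ → GödelJ.GAxiom (χ ⋆⁻¹)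
⋆⁻¹-GAxiom (Gödel⋆.A1 _ _ _)  = GödelJ.A1 _ _ _
⋆⁻¹-GAxiom (Gödel⋆.A2 _ _)    = GödelJ.A2 _ _
⋆⁻¹-GAxiom (Gödel⋆.A3 _ _)    = GödelJ.A3 _ _
⋆⁻¹-GAxiom (Gödel⋆.A5a _ _ _) = GödelJ.A5a _ _ _
⋆⁻¹-GAxiom (Gödel⋆.A5b _ _ _) = GödelJ.A5b _ _ _
⋆⁻¹-GAxiom (Gödel⋆.A6 _ _ _)  = GödelJ.A6 _ _ _
⋆⁻¹-GAxiom (Gödel⋆.A7 _)      = GödelJ.A7 _
⋆⁻¹-GAxiom (Gödel⋆.G4 _)      = GödelJ.G4 _

Der-mono : ∀ {L CS} {Γ Δ : Pred Fm} → (∀ {ψ} → Γ ψ → Δ ψ) →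
           ∀ {φ} → Der L CS Γ φ → Der L CS Δ φ
Der-mono Γ⊆Δ (prem g) = prem (Γ⊆Δ g)
Der-mono Γ⊆Δ (ax a)   = ax a
Der-mono Γ⊆Δ (cs c)   = cs c
Der-mono Γ⊆Δ (mp d e) = mp (Der-mono Γ⊆Δ d) (Der-mono Γ⊆Δ e)

Th⇒Der : ∀ {L CS Γ φ} → Th L CS φ → Der L CS Γ φ
Th⇒Der = Der-mono (λ ())

Der⇒⊢G : ∀ {L CS Γ φ} → Der L CS Γ φ → (image⋆ Γ ∪ image⋆ (Th L CS)) ⊢G (φ ⋆)
Der⇒⊢G (prem g) = prem (inj₁ (_ , g , refl))
Der⇒⊢G (ax a)   = prem (inj₂ (_ , ax a , refl))
Der⇒⊢G (cs c)   = prem (inj₂ (_ , cs c , refl))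
Der⇒⊢G (mp d e) = mp (Der⇒⊢G d) (Der⇒⊢G e)

⊢G⇒Der-⋆⁻¹ : ∀ {L CS Γ} {Δ : Pred L0⋆} → (∀ {χ} → Δ χ → Der L CS Γ (χ ⋆⁻¹)) →
             ∀ {χ} → Δ ⊢G χ → Der L CS Γ (χ ⋆⁻¹)
⊢G⇒Der-⋆⁻¹ pullback (prem p) = pullback p
⊢G⇒Der-⋆⁻¹ pullback (ax a)   = ax (gax (⋆⁻¹-GAxiom a))
⊢G⇒Der-⋆⁻¹ pullback (mp d e) = mp (⊢G⇒Der-⋆⁻¹ pullback d) (⊢G⇒Der-⋆⁻¹ pullback e)

Der-image⋆ : ∀ {L CS} {Δ Γ : Pred Fm} → (∀ {ψ} → Δ ψ → Der L CS Γ ψ) →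
             ∀ {χ} → image⋆ Δ χ → Der L CS Γ (χ ⋆⁻¹)
Der-image⋆ {L} {CS} {Γ = Γ} Δ⊆Der (ψ , δ , refl) =
  subst (Der L CS Γ) (sym (⋆⁻¹-⋆ ψ)) (Δ⊆Der δ)

-- CS enters only through its instances, which are theorems.
mainTheorem18 : (L : Logic) (CS : Pred Fm) → IsCS L CS →
    (Γ : Pred Fm) (φ : Fm) →
    (Der L CS Γ φ → (image⋆ Γ ∪ image⋆ (Th L CS)) ⊢G (φ ⋆))
    × ((image⋆ Γ ∪ image⋆ (Th L CS)) ⊢G (φ ⋆) → Der L CS Γ φ)
mainTheorem18 L CS _ Γ φ = Der⇒⊢G , ⊢G⇒Der
  where
  premises⇒Der : ∀ {χ} → (image⋆ Γ ∪ image⋆ (Th L CS)) χ → Der L CS Γ (χ ⋆⁻¹)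
  premises⇒Der = [ Der-image⋆ prem , Der-image⋆ Th⇒Der ]

  ⊢G⇒Der : (image⋆ Γ ∪ image⋆ (Th L CS)) ⊢G (φ ⋆) → Der L CS Γ φ
  ⊢G⇒Der d = subst (Der L CS Γ) (⋆⁻¹-⋆ φ) (⊢G⇒Der-⋆⁻¹ premises⇒Der d)
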